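{- Let $T_1,\dots,T_{n_t}$ be target points on the $x$-axis with $x(T_1)\le\cdots\le x(T_{n_t})$, let $S$ be a finite set of sensors with coverage intervals $[u_s,v_s]$ (sensor $s$ covers $T_j$ iff $u_s\le x(T_j)\le v_s$), and let $K\ge 1$ be an integer. Assume some subset of $S$ $K$-covers all targets (every target is covered by at least $K$ sensors of the subset). Then the set of sensors output by the algorithm $K$-OGA (defined in the context) $K$-covers all targets and has the minimum cardinality among all subsets of $S$ that $K$-cover all targets.
   Context: OGA (order-based greedy algorithm), applied to a set of targets $NC$ with an available sensor set $RS$: repeatedly take the leftmost target of $NC$ not yet covered by the sensors selected in this run, and select from $RS$, among sensors covering it, one with the largest right endpoint (ties broken in favor of the sensor covering the most targets); stop when all targets of $NC$ are covered. $K$-OGA: set $s=1$, $RS_1=S$, $NC_1=$ all targets, and apply OGA to $NC_1$ using $RS_1$. Then, while some target is covered by fewer than $K$ selected sensors: increase $s$ by one, let $RS_s$ be the set of sensors of $S$ not selected so far and $NC_s$ the set of targets covered by fewer than $s$ selected sensors, and apply OGA to $NC_s$ using $RS_s$, adding the newly selected sensors to the selected set. The output is the set of all selected sensors. (Weak $K$-barrier coverage of a belt region is modeled this way: sensor coverage areas are projected orthogonally onto the boundary line, and the continuous interval to be $K$-covered is converted to discrete targets, one at the midpoint of each elementary interval determined by the interval endpoints.)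
   Formalization: The target coordinates $x(T_j)$ and the endpoints $u_s$, $v_s$ of the sensors' coverage intervals are rational numbers. -}

module Defs where

open import Data.Nat as ℕ using (ℕ; suc)
open import Data.Fin as Fin using (Fin)
open import Data.Fin.Subset as Sub using (Subset; _∈_; _∉_; _∪_; _∩_; ⁅_⁆; ∁; ∣_∣)
  renaming (⊥ to ∅; ⊤ to Full)
open import Data.Rational as ℚ using (ℚ)
open import Data.Product using (_×_; ∃; ∃-syntax)
open import Data.Vec using (tabulate)
open import Relation.Nullary using (¬_; does)
open import Relation.Nullary.Decidable using (_×-dec_)
open import Relation.Binary.PropositionalEquality using (_≡_)

record Instance : Set where
  field
    nt : ℕ
    m  : ℕ
    x  : Fin nt → ℚ
    u  : Fin m → ℚ
    v  : Fin m → ℚ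
open Instance public

module _ (I : Instance) where

  Sorted : Set
  Sorted = ∀ (i j : Fin (nt I)) → i Fin.≤ j → x I i ℚ.≤ x I j

  Covers : Fin (m I) → Fin (nt I) → Set
  Covers s j = (u I s ℚ.≤ x I j) × (x I j ℚ.≤ v I s)

  coverers : Fin (nt I) → Subset (m I)
  coverers j = tabulate (λ s → does ((u I s ℚ.≤? x I j) ×-dec (x I j ℚ.≤? v I s)))

  covered : Fin (m I) → Subset (nt I)
  covered s = tabulate (λ j → does ((u I s ℚ.≤? x I j) ×-dec (x I j ℚ.≤? v I s)))

  covCount : Subset (m I) → Fin (nt I) → ℕ
  covCount A j = ∣ A ∩ coverers j ∣

  KCovers : ℕ → Subset (m I) → Set
  KCovers K A = ∀ (j : Fin (nt I)) → K ℕ.≤ covCount A j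

  CoveredBy : Subset (m I) → Fin (nt I) → Set
  CoveredBy C j = ∃[ s ] (s ∈ C × Covers s j)

  LeftmostUncovered : Subset (nt I) → Subset (m I) → Fin (nt I) → Set
  LeftmostUncovered NC C j =
    j ∈ NC × ¬ CoveredBy C j ×
    (∀ j' → j' ∈ NC → ¬ CoveredBy C j' → x I j ℚ.≤ x I j')

  GreedyChoice : Subset (m I) → Fin (nt I) → Fin (m I) → Set
  GreedyChoice RS j s =
    s ∈ RS × Covers s j ×
    (∀ s' → s' ∈ RS → Covers s' j → v I s' ℚ.≤ v I s) ×
    (∀ s' → s' ∈ RS → Covers s' j → v I s' ≡ v I s →
       ∣ covered s' ∣ ℕ.≤ ∣ covered s ∣)

  -- OGARun NC RS C C' : a (terminating) run of OGA on NC using RS which,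
  -- having selected C so far in this run, ends with selected set C'.
  data OGARun (NC : Subset (nt I)) (RS : Subset (m I)) :
              Subset (m I) → Subset (m I) → Set where
    stop : ∀ {C} → (∀ j → j ∈ NC → CoveredBy C j) → OGARun NC RS C C
    step : ∀ {C C'} (j : Fin (nt I)) (s : Fin (m I)) →
           LeftmostUncovered NC C j → GreedyChoice RS j s →
           OGARun NC RS (C ∪ ⁅ s ⁆) C' → OGARun NC RS C C'

  OGA : Subset (nt I) → Subset (m I) → Subset (m I) → Set
  OGA NC RS C = OGARun NC RS ∅ C

  underCovered : ℕ → Subset (m I) → Subset (nt I)
  underCovered s Sel = tabulate (λ j → does (suc (covCount Sel j) ℕ.≤? s))

  -- KRun K s Sel Out : K-OGA, after completing round s with selected set Sel,
  -- terminates with output Out.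
  data KRun (K : ℕ) : ℕ → Subset (m I) → Subset (m I) → Set where
    done : ∀ {s Sel} → KCovers K Sel → KRun K s Sel Sel
    next : ∀ {s Sel C Out} →
           (∃[ j ] covCount Sel j ℕ.< K) →
           OGA (underCovered (suc s) Sel) (∁ Sel) C →
           KRun K (suc s) (Sel ∪ C) Out →
           KRun K s Sel Out

  KOGA : ℕ → Subset (m I) → Set
  KOGA K Out = ∃[ C ] (OGA Full Full C × KRun K 1 C Out)

-- An exchange argument, round by round. Before round s + 1 every target is covered at least
-- s times by the set Sel chosen in earlier rounds; let C be the sensors chosen so far in the
-- current round. Invariant: Sel ∪ C is contained in a K-cover A of minimum size. Suppose OGA
-- selects g ∉ A for the leftmost target j that is covered exactly s times and not by C. Let t be
-- the sensor of A outside Sel that covers j and has the largest left endpoint; g reaches at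
-- least as far right as t. Exchanging t for g keeps a K-cover: a target i covered by t but not
-- by g lies left of j, so Sel ∪ C already covers it s + 1 times, and every sensor of A outside
-- Sel ∪ C covering j also covers i. Hence cov_A(j) + cov_{Sel∪C}(i) ≤ cov_A(i) + cov_{Sel∪C}(j),
-- and with cov_A(j) ≥ K and cov_{Sel∪C}(j) ≤ s this gives cov_A(i) ≥ K + 1. Each round raises
-- the minimum coverage by one, so K-OGA stops after at most K rounds, with its output contained
-- in a minimum K-cover.

module Submission where

open import Defs

open import Data.Fin.Base using (Fin)
open import Data.Fin.Properties using (any?)
open import Data.Fin.Subset using (Subset; ∣_∣; _∈_; _∉_; _⊆_; _∩_; _∪_; ∁; ⁅_⁆; inside; outside)
  renaming (⊥ to ∅; ⊤ to Full)
open import Data.Fin.Subset.Properties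
open import Data.List.Base using (List; filter; allFin)
open import Data.List.Membership.Propositional.Properties using (∈-filter⁺; ∈-allFin)
import Data.List.Relation.Unary.All as All
open import Data.List.Relation.Unary.All.Properties using (all-filter)
open import Data.Nat.Base using (ℕ; zero; suc; _+_; _≤_; _<_; z≤n; s≤s)
open import Data.Nat.Induction using (<-wellFounded)
open import Data.Nat.Properties
open import Algebra.Properties.CommutativeSemigroup +-commutativeSemigroup using (xy∙z≈zy∙x)
open import Data.Product using (_×_; _,_; ∃; ∃-syntax; proj₁; proj₂)
import Data.Rational as ℚ
import Data.Rational.Properties as ℚ
open import Data.Sum using (_⊎_; inj₁; inj₂)
open import Data.Vec.Base using (_∷_; []; tabulate)
open import Data.Vec.Properties using (lookup∘tabulate; []=⇒lookup; lookup⇒[]=)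
open import Function.Base using (_∘_)
open import Induction.WellFounded using (Acc; acc)
open import Relation.Binary.Bundles using (TotalOrder; DecTotalOrder)
open import Relation.Binary.PropositionalEquality
open import Relation.Nullary using (¬_; Dec; yes; no; does; ¬?; contradiction)
open import Relation.Nullary.Decidable using (_×-dec_; dec-true; decidable-stable)
open import Relation.Unary using (Pred; Decidable)

-- Subsets of Fin n

private variable
  n : ℕ
  p q X Y : Subset n
  w y z : Fin n

∈-tabulate-does⁺ : ∀ {ℓ} {P : Pred (Fin n) ℓ} (P? : Decidable P) → P w → w ∈ tabulate (does ∘ P?)
∈-tabulate-does⁺ {w = w} P? Pw = lookup⇒[]= w _ (trans (lookup∘tabulate _ w) (dec-true (P? w) Pw))

∈-tabulate-does⁻ : ∀ {ℓ} {P : Pred (Fin n) ℓ} (P? : Decidable P) → w ∈ tabulate (does ∘ P?) → P w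
∈-tabulate-does⁻ {w = w} P? w∈ with P? w | trans (sym (lookup∘tabulate (does ∘ P?) w)) ([]=⇒lookup w∈)
... | yes Pw | _  = Pw
... | no _   | ()

∣p∣≡∣p∩q∣+∣p∩∁q∣ : ∀ (p q : Subset n) → ∣ p ∣ ≡ ∣ p ∩ q ∣ + ∣ p ∩ ∁ q ∣
∣p∣≡∣p∩q∣+∣p∩∁q∣ []            []            = refl
∣p∣≡∣p∩q∣+∣p∩∁q∣ (outside ∷ p) (_       ∷ q) = ∣p∣≡∣p∩q∣+∣p∩∁q∣ p q
∣p∣≡∣p∩q∣+∣p∩∁q∣ (inside  ∷ p) (inside  ∷ q) = cong suc (∣p∣≡∣p∩q∣+∣p∩∁q∣ p q)
∣p∣≡∣p∩q∣+∣p∩∁q∣ (inside  ∷ p) (outside ∷ q) =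
  trans (cong suc (∣p∣≡∣p∩q∣+∣p∩∁q∣ p q)) (sym (+-suc _ _))

y∈p⇒0<∣p∣ : ∀ {n} {y : Fin n} {p} → y ∈ p → 0 < ∣ p ∣
y∈p⇒0<∣p∣ {n} {y} {p} y∈p = subst (_< ∣ p ∣) (∣⊥∣≡0 n) (p⊂q⇒∣p∣<∣q∣ (⊥⊆ , y , y∈p , ∉⊥))

∣q∣<∣p∣⇒∃y∈p∧y∉q : ∣ q ∣ < ∣ p ∣ → ∃[ y ] y ∈ p × y ∉ q
∣q∣<∣p∣⇒∃y∈p∧y∉q {q = q} {p = p} ∣q∣<∣p∣ with any? (λ w → (w ∈? p) ×-dec ¬? (w ∈? q))
... | yes found = found
... | no none   = contradiction (p⊆q⇒∣p∣≤∣q∣ p⊆q) (<⇒≱ ∣q∣<∣p∣)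
  where
  p⊆q : p ⊆ q
  p⊆q {w} w∈p = decidable-stable (w ∈? q) (λ w∉q → none (w , w∈p , w∉q))

p∩X⊆q∩X : (∀ {w} → w ∈ p → w ∈ X → w ∈ q) → p ∩ X ⊆ q ∩ X
p∩X⊆q∩X {p = p} {X = X} ⊆q w∈ with x∈p∩q⁻ p X w∈
... | w∈p , w∈X = x∈p∩q⁺ (⊆q w∈p w∈X , w∈X)

p⊆q∧y∈q⇒p∪⁅y⁆⊆q : p ⊆ q → y ∈ q → p ∪ ⁅ y ⁆ ⊆ q
p⊆q∧y∈q⇒p∪⁅y⁆⊆q {p = p} {y = y} p⊆q y∈q w∈ with x∈p∪q⁻ p ⁅ y ⁆ w∈
... | inj₁ w∈p   = p⊆q w∈p
... | inj₂ w∈⁅y⁆ rewrite x∈⁅y⁆⇒x≡y y w∈⁅y⁆ = y∈q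

y∉p⇒∣∁[p∪⁅y⁆]∣<∣∁p∣ : y ∉ p → ∣ ∁ (p ∪ ⁅ y ⁆) ∣ < ∣ ∁ p ∣
y∉p⇒∣∁[p∪⁅y⁆]∣<∣∁p∣ {y = y} {p = p} y∉p = p⊂q⇒∣p∣<∣q∣
  (p⊆q⇒∁p⊇∁q (p⊆p∪q ⁅ y ⁆) , y , x∉p⇒x∈∁p y∉p , x∈p⇒x∉∁p (q⊆p∪q p ⁅ y ⁆ (x∈⁅x⁆ y)))

w∈p∩∁⁅y⁆⁺ : w ∈ p → w ≢ y → w ∈ p ∩ ∁ ⁅ y ⁆
w∈p∩∁⁅y⁆⁺ w∈p w≢y = x∈p∩q⁺ (w∈p , x∉p⇒x∈∁p (x≢y⇒x∉⁅y⁆ w≢y))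

w∈p∩∁⁅y⁆⁻ : ∀ (p : Subset n) y → w ∈ p ∩ ∁ ⁅ y ⁆ → w ∈ p × w ≢ y
w∈p∩∁⁅y⁆⁻ p y w∈ with x∈p∩q⁻ p (∁ ⁅ y ⁆) w∈
... | w∈p , w∈∁⁅y⁆ = w∈p , x∉⁅y⁆⇒x≢y (x∈∁p⇒x∉p w∈∁⁅y⁆)

∣p∣≤1+∣p∩∁⁅y⁆∣ : ∀ (p : Subset n) y → ∣ p ∣ ≤ suc ∣ p ∩ ∁ ⁅ y ⁆ ∣
∣p∣≤1+∣p∩∁⁅y⁆∣ p y = begin
  ∣ p ∣                              ≡⟨ ∣p∣≡∣p∩q∣+∣p∩∁q∣ p ⁅ y ⁆ ⟩
  ∣ p ∩ ⁅ y ⁆ ∣ + ∣ p ∩ ∁ ⁅ y ⁆ ∣    ≤⟨ +-monoˡ-≤ _ ∣p∩⁅y⁆∣≤1 ⟩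
  suc ∣ p ∩ ∁ ⁅ y ⁆ ∣                ∎
  where
  open ≤-Reasoning
  ∣p∩⁅y⁆∣≤1 : ∣ p ∩ ⁅ y ⁆ ∣ ≤ 1
  ∣p∩⁅y⁆∣≤1 = ≤-trans (∣p∩q∣≤∣q∣ p ⁅ y ⁆) (≤-reflexive (∣⁅x⁆∣≡1 y))

y∈p⇒1+∣p∩∁⁅y⁆∣≤∣p∣ : ∀ (p : Subset n) → y ∈ p → suc ∣ p ∩ ∁ ⁅ y ⁆ ∣ ≤ ∣ p ∣
y∈p⇒1+∣p∩∁⁅y⁆∣≤∣p∣ {y = y} p y∈p = begin
  suc ∣ p ∩ ∁ ⁅ y ⁆ ∣                ≤⟨ +-monoˡ-≤ _ (y∈p⇒0<∣p∣ (x∈p∩q⁺ (y∈p , x∈⁅x⁆ y))) ⟩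
  ∣ p ∩ ⁅ y ⁆ ∣ + ∣ p ∩ ∁ ⁅ y ⁆ ∣    ≡⟨ ∣p∣≡∣p∩q∣+∣p∩∁q∣ p ⁅ y ⁆ ⟨
  ∣ p ∣                              ∎
  where open ≤-Reasoning

replace : Fin n → Fin n → Subset n → Subset n
replace y z p = ⁅ z ⁆ ∪ p ∩ ∁ ⁅ y ⁆

p∩∁⁅y⁆⊆replace : ∀ z (p : Subset n) → p ∩ ∁ ⁅ y ⁆ ⊆ replace y z p
p∩∁⁅y⁆⊆replace {y = y} z p = q⊆p∪q ⁅ z ⁆ (p ∩ ∁ ⁅ y ⁆)

replace-⊇ : q ⊆ p → y ∉ q → q ∪ ⁅ z ⁆ ⊆ replace y z p
replace-⊇ {q = q} {p = p} {y = y} {z = z} q⊆p y∉q w∈ with x∈p∪q⁻ q ⁅ z ⁆ w∈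
... | inj₁ w∈q   = p∩∁⁅y⁆⊆replace z p (w∈p∩∁⁅y⁆⁺ (q⊆p w∈q) λ { refl → y∉q w∈q })
... | inj₂ w∈⁅z⁆ rewrite x∈⁅y⁆⇒x≡y z w∈⁅z⁆ = p⊆p∪q (p ∩ ∁ ⁅ y ⁆) (x∈⁅x⁆ z)

∣replace∣≤∣p∣ : ∀ z (p : Subset n) → y ∈ p → ∣ replace y z p ∣ ≤ ∣ p ∣
∣replace∣≤∣p∣ {y = y} z p y∈p = begin
  ∣ replace y z p ∣                    ≤⟨ ∣p∣≤1+∣p∩∁⁅y⁆∣ (replace y z p) z ⟩
  suc ∣ replace y z p ∩ ∁ ⁅ z ⁆ ∣      ≤⟨ s≤s (p⊆q⇒∣p∣≤∣q∣ only-p) ⟩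
  suc ∣ p ∩ ∁ ⁅ y ⁆ ∣                  ≤⟨ y∈p⇒1+∣p∩∁⁅y⁆∣≤∣p∣ p y∈p ⟩
  ∣ p ∣                                ∎
  where
  open ≤-Reasoning
  only-p : replace y z p ∩ ∁ ⁅ z ⁆ ⊆ p ∩ ∁ ⁅ y ⁆
  only-p w∈ with w∈p∩∁⁅y⁆⁻ (replace y z p) z w∈
  ... | w∈replace , w≢z with x∈p∪q⁻ ⁅ z ⁆ (p ∩ ∁ ⁅ y ⁆) w∈replace
  ...   | inj₁ w∈⁅z⁆ = contradiction (x∈⁅y⁆⇒x≡y z w∈⁅z⁆) w≢z
  ...   | inj₂ w∈p∖y = w∈p∖y

p∩X∩∁⁅y⁆⊆replace∩X : ∀ y z (p X : Subset n) → (p ∩ X) ∩ ∁ ⁅ y ⁆ ⊆ replace y z p ∩ X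
p∩X∩∁⁅y⁆⊆replace∩X y z p X w∈ with w∈p∩∁⁅y⁆⁻ (p ∩ X) y w∈
... | w∈p∩X , w≢y with x∈p∩q⁻ p X w∈p∩X
...   | w∈p , w∈X = x∈p∩q⁺ (p∩∁⁅y⁆⊆replace z p (w∈p∩∁⁅y⁆⁺ w∈p w≢y) , w∈X)

∣p∩X∣≤1+∣replace∩X∣ : ∀ z (p X : Subset n) → ∣ p ∩ X ∣ ≤ suc ∣ replace y z p ∩ X ∣
∣p∩X∣≤1+∣replace∩X∣ {y = y} z p X = begin
  ∣ p ∩ X ∣                      ≤⟨ ∣p∣≤1+∣p∩∁⁅y⁆∣ (p ∩ X) y ⟩
  suc ∣ (p ∩ X) ∩ ∁ ⁅ y ⁆ ∣      ≤⟨ s≤s (p⊆q⇒∣p∣≤∣q∣ (p∩X∩∁⁅y⁆⊆replace∩X y z p X)) ⟩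
  suc ∣ replace y z p ∩ X ∣      ∎
  where open ≤-Reasoning

y∉X⇒∣p∩X∣≤∣replace∩X∣ : ∀ z (p X : Subset n) → y ∉ X → ∣ p ∩ X ∣ ≤ ∣ replace y z p ∩ X ∣
y∉X⇒∣p∩X∣≤∣replace∩X∣ {y = y} z p X y∉X = p⊆q⇒∣p∣≤∣q∣ (p∩X⊆q∩X {q = replace y z p} (λ w∈p w∈X →
  p∩∁⁅y⁆⊆replace z p (w∈p∩∁⁅y⁆⁺ w∈p λ { refl → y∉X w∈X })))

z∈X⇒∣p∩X∣≤∣replace∩X∣ : ∀ z (p X : Subset n) → z ∉ p → z ∈ X → ∣ p ∩ X ∣ ≤ ∣ replace y z p ∩ X ∣
z∈X⇒∣p∩X∣≤∣replace∩X∣ {y = y} z p X z∉p z∈X = begin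
  ∣ p ∩ X ∣                                ≤⟨ ∣p∣≤1+∣p∩∁⁅y⁆∣ (p ∩ X) y ⟩
  suc ∣ (p ∩ X) ∩ ∁ ⁅ y ⁆ ∣                ≤⟨ s≤s (p⊆q⇒∣p∣≤∣q∣ kept) ⟩
  suc ∣ (replace y z p ∩ X) ∩ ∁ ⁅ z ⁆ ∣    ≤⟨ y∈p⇒1+∣p∩∁⁅y⁆∣≤∣p∣ (replace y z p ∩ X) z∈ ⟩
  ∣ replace y z p ∩ X ∣                    ∎
  where
  open ≤-Reasoning
  z∈ : z ∈ replace y z p ∩ X
  z∈ = x∈p∩q⁺ (p⊆p∪q (p ∩ ∁ ⁅ y ⁆) (x∈⁅x⁆ z) , z∈X)
  kept : (p ∩ X) ∩ ∁ ⁅ y ⁆ ⊆ (replace y z p ∩ X) ∩ ∁ ⁅ z ⁆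
  kept w∈ = w∈p∩∁⁅y⁆⁺ (p∩X∩∁⁅y⁆⊆replace∩X y z p X w∈)
                      λ { refl → z∉p (p∩q⊆p p X (p∩q⊆p (p ∩ X) _ w∈)) }

∣p∩X∣+∣q∩Y∣≤∣p∩Y∣+∣q∩X∣ : ∀ (p q X Y : Subset n) → q ⊆ p → (∀ {w} → w ∈ p → w ∉ q → w ∈ X → w ∈ Y) →
                          ∣ p ∩ X ∣ + ∣ q ∩ Y ∣ ≤ ∣ p ∩ Y ∣ + ∣ q ∩ X ∣
∣p∩X∣+∣q∩Y∣≤∣p∩Y∣+∣q∩X∣ p q X Y q⊆p moved = begin
  ∣ p ∩ X ∣ + ∣ q ∩ Y ∣
    ≡⟨ cong (_+ ∣ q ∩ Y ∣) (∣p∣≡∣p∩q∣+∣p∩∁q∣ (p ∩ X) q) ⟩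
  ∣ (p ∩ X) ∩ q ∣ + ∣ (p ∩ X) ∩ ∁ q ∣ + ∣ q ∩ Y ∣
    ≤⟨ +-mono-≤ (+-mono-≤ (p⊆q⇒∣p∣≤∣q∣ inside-q) (p⊆q⇒∣p∣≤∣q∣ outside-q)) (p⊆q⇒∣p∣≤∣q∣ q∩Y⊆) ⟩
  ∣ q ∩ X ∣ + ∣ (p ∩ Y) ∩ ∁ q ∣ + ∣ (p ∩ Y) ∩ q ∣
    ≡⟨ xy∙z≈zy∙x (∣ q ∩ X ∣) (∣ (p ∩ Y) ∩ ∁ q ∣) (∣ (p ∩ Y) ∩ q ∣) ⟩
  ∣ (p ∩ Y) ∩ q ∣ + ∣ (p ∩ Y) ∩ ∁ q ∣ + ∣ q ∩ X ∣
    ≡⟨ cong (_+ ∣ q ∩ X ∣) (∣p∣≡∣p∩q∣+∣p∩∁q∣ (p ∩ Y) q) ⟨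
  ∣ p ∩ Y ∣ + ∣ q ∩ X ∣
    ∎
  where
  open ≤-Reasoning
  inside-q : (p ∩ X) ∩ q ⊆ q ∩ X
  inside-q w∈ with x∈p∩q⁻ (p ∩ X) q w∈
  ... | w∈p∩X , w∈q = x∈p∩q⁺ (w∈q , proj₂ (x∈p∩q⁻ p X w∈p∩X))
  outside-q : (p ∩ X) ∩ ∁ q ⊆ (p ∩ Y) ∩ ∁ q
  outside-q w∈ with x∈p∩q⁻ (p ∩ X) (∁ q) w∈
  ... | w∈p∩X , w∈∁q with x∈p∩q⁻ p X w∈p∩X
  ...   | w∈p , w∈X = x∈p∩q⁺ (x∈p∩q⁺ (w∈p , moved w∈p (x∈∁p⇒x∉p w∈∁q) w∈X) , w∈∁q)
  q∩Y⊆ : q ∩ Y ⊆ (p ∩ Y) ∩ q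
  q∩Y⊆ w∈ with x∈p∩q⁻ q Y w∈
  ... | w∈q , w∈Y = x∈p∩q⁺ (x∈p∩q⁺ (q⊆p w∈q , w∈Y) , w∈q)

module _ {c ℓ₁ ℓ₂} (O : TotalOrder c ℓ₁ ℓ₂) where
  open TotalOrder O using (Carrier) renaming (_≤_ to _≼_)
  open import Data.List.Extrema O
    using (argmax; argmin; argmax-all; argmin-all; f[xs]≤f[argmax]; f[argmin]≤f[xs])

  ∃-argmax : ∀ {ℓ} {P : Pred (Fin n) ℓ} → Decidable P → (f : Fin n → Carrier) →
             ∃ P → ∃[ k ] P k × (∀ l → P l → f l ≼ f k)
  ∃-argmax {n} {P = P} P? f (k₀ , Pk₀) = k , argmax-all f Pk₀ (all-filter P? (allFin n)) , maximal
    where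
    candidates : List (Fin n)
    candidates = filter P? (allFin n)
    k : Fin n
    k = argmax f k₀ candidates
    maximal : ∀ l → P l → f l ≼ f k
    maximal l Pl = All.lookup (f[xs]≤f[argmax] k₀ candidates) (∈-filter⁺ P? (∈-allFin l) Pl)

  ∃-argmin : ∀ {ℓ} {P : Pred (Fin n) ℓ} → Decidable P → (f : Fin n → Carrier) →
             ∃ P → ∃[ k ] P k × (∀ l → P l → f k ≼ f l)
  ∃-argmin {n} {P = P} P? f (k₀ , Pk₀) = k , argmin-all f Pk₀ (all-filter P? (allFin n)) , minimal
    where
    candidates : List (Fin n)
    candidates = filter P? (allFin n)
    k : Fin n
    k = argmin f k₀ candidates
    minimal : ∀ l → P l → f k ≼ f l
    minimal l Pl = All.lookup (f[argmin]≤f[xs] k₀ candidates) (∈-filter⁺ P? (∈-allFin l) Pl)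

ℚ-≤-totalOrder : TotalOrder _ _ _
ℚ-≤-totalOrder = DecTotalOrder.totalOrder ℚ.≤-decTotalOrder

-- Coverage of targets by sensors

module _ (I : Instance) where

  private variable
    A C C′ P Out RS Sel : Subset (m I)
    NC : Subset (nt I)
    g r t : Fin (m I)
    i j : Fin (nt I)
    b s K : ℕ

  Covers? : ∀ r j → Dec (Covers I r j)
  Covers? r j = (u I r ℚ.≤? x I j) ×-dec (x I j ℚ.≤? v I r)

  ∈-coverers⁺ : Covers I r j → r ∈ coverers I j
  ∈-coverers⁺ {j = j} = ∈-tabulate-does⁺ (λ r → Covers? r j)

  ∈-coverers⁻ : r ∈ coverers I j → Covers I r j
  ∈-coverers⁻ {j = j} = ∈-tabulate-does⁻ (λ r → Covers? r j)

  CoveredBy? : ∀ C j → Dec (CoveredBy I C j)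
  CoveredBy? C j = any? (λ r → (r ∈? C) ×-dec Covers? r j)

  covCount-mono : ∀ A P → (∀ {r} → r ∈ A → Covers I r j → r ∈ P) → covCount I A j ≤ covCount I P j
  covCount-mono _ _ ⊆P = p⊆q⇒∣p∣≤∣q∣ (p∩X⊆q∩X (λ r∈A r∈Cj → ⊆P r∈A (∈-coverers⁻ r∈Cj)))

  covCount-strict : A ⊆ P → r ∉ A → r ∈ P → Covers I r j → covCount I A j < covCount I P j
  covCount-strict {A} {P} {r} {j} A⊆P r∉A r∈P r-covers =
    p⊂q⇒∣p∣<∣q∣ (p∩X⊆q∩X (λ r∈A _ → A⊆P r∈A) , r , x∈p∩q⁺ (r∈P , ∈-coverers⁺ r-covers) , r∉A∩Cj)
    where
    r∉A∩Cj : r ∉ A ∩ coverers I j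
    r∉A∩Cj r∈ = r∉A (proj₁ (x∈p∩q⁻ A (coverers I j) r∈))

  leftmost-uncovered? : ∀ NC C → (∀ j → j ∈ NC → CoveredBy I C j) ⊎ ∃ (LeftmostUncovered I NC C)
  leftmost-uncovered? NC C with any? (λ j → (j ∈? NC) ×-dec ¬? (CoveredBy? C j))
  ... | no none =
    inj₁ (λ j j∈NC → decidable-stable (CoveredBy? C j) (λ uncovered → none (j , j∈NC , uncovered)))
  ... | yes some with j , (j∈NC , uncovered) , leftmost ←
                        ∃-argmin ℚ-≤-totalOrder (λ j → (j ∈? NC) ×-dec ¬? (CoveredBy? C j)) (x I) some =
    inj₂ (j , j∈NC , uncovered , λ j′ j′∈NC uncovered′ → leftmost j′ (j′∈NC , uncovered′))

  greedy-choice-exists : (∃[ r ] r ∈ RS × Covers I r j) → ∃ (GreedyChoice I RS j)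
  greedy-choice-exists {RS} {j} candidate
    with h , (h∈RS , h-covers) , h-furthest ←
           ∃-argmax ℚ-≤-totalOrder (λ r → (r ∈? RS) ×-dec Covers? r j) (v I) candidate
    with g , ((g∈RS , g-covers) , vg≡vh) , g-most ←
           ∃-argmax ≤-totalOrder (λ r → ((r ∈? RS) ×-dec Covers? r j) ×-dec (v I r ℚ.≟ v I h))
                    (∣_∣ ∘ covered I) (h , (h∈RS , h-covers) , refl) =
    g , g∈RS , g-covers ,
    (λ r r∈RS r-covers → subst (v I r ℚ.≤_) (sym vg≡vh) (h-furthest r (r∈RS , r-covers))) ,
    (λ r r∈RS r-covers vr≡vg → g-most r ((r∈RS , r-covers) , trans vr≡vg vg≡vh))

  replace-KCovers : g ∉ A → KCovers I K A →
                    (∀ i → Covers I t i → ¬ Covers I g i → suc K ≤ covCount I A i) →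
                    KCovers I K (replace t g A)
  replace-KCovers {g} {A} {K} {t} g∉A A-covers lost i with Covers? t i | Covers? g i
  ... | no t-misses | _ =
    ≤-trans (A-covers i) (y∉X⇒∣p∩X∣≤∣replace∩X∣ g A (coverers I i) (t-misses ∘ ∈-coverers⁻))
  ... | yes _ | yes g-covers =
    ≤-trans (A-covers i) (z∈X⇒∣p∩X∣≤∣replace∩X∣ g A (coverers I i) g∉A (∈-coverers⁺ g-covers))
  ... | yes t-covers | no g-misses =
    ≤-pred (≤-trans (lost i t-covers g-misses) (∣p∩X∣≤1+∣replace∩X∣ g A (coverers I i)))

  uncovered-∪⁻ : ¬ CoveredBy I C j → r ∈ A ∪ C → Covers I r j → r ∈ A
  uncovered-∪⁻ {C} {A = A} j-uncovered r∈ r-covers with x∈p∪q⁻ A C r∈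
  ... | inj₁ r∈A = r∈A
  ... | inj₂ r∈C = contradiction (_ , r∈C , r-covers) j-uncovered

  Extendable : ℕ → ℕ → Subset (m I) → Set
  Extendable K b P = ∃[ A ] (KCovers I K A × P ⊆ A × ∣ A ∣ ≤ b)

  Extendable⇒∣P∣≤b : Extendable K b P → ∣ P ∣ ≤ b
  Extendable⇒∣P∣≤b (A , _ , P⊆A , ∣A∣≤b) = ≤-trans (p⊆q⇒∣p∣≤∣q∣ P⊆A) ∣A∣≤b

  KCovers⇒Extendable : ∀ A → KCovers I K A → Extendable K ∣ A ∣ ∅
  KCovers⇒Extendable A A-covers = A , A-covers , ⊥⊆ , ≤-refl

  -- One round of K-OGA

  -- The state before round s + 1: Sel was selected in rounds 1, …, s, NC holds the targets
  -- covered exactly s times and RS the sensors not selected yet. Round 1 is stated in Defs with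
  -- NC = RS = Full rather than through underCovered and ∁, hence these properties instead of
  -- equations.
  record RoundSetup (s : ℕ) (Sel : Subset (m I)) (NC : Subset (nt I)) (RS : Subset (m I)) : Set where
    field
      level    : ∀ j → s ≤ covCount I Sel j
      NC-under : j ∈ NC → covCount I Sel j ≤ s
      NC-over  : j ∉ NC → suc s ≤ covCount I Sel j
      RS-fresh : r ∈ RS → r ∉ Sel
      RS-all   : r ∉ Sel → r ∈ RS

  first-round : RoundSetup 0 ∅ Full Full
  first-round = record
    { level    = λ _ → z≤n
    ; NC-under = λ {j} _ → ≤-reflexive (trans (cong ∣_∣ (∩-zeroˡ (coverers I j))) (∣⊥∣≡0 (m I)))
    ; NC-over  = λ j∉Full → contradiction ∈⊤ j∉Full
    ; RS-fresh = λ _ → ∉⊥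
    ; RS-all   = λ _ → ∈⊤
    }

  later-round : (∀ j → s ≤ covCount I Sel j) → RoundSetup s Sel (underCovered I (suc s) Sel) (∁ Sel)
  later-round {s} {Sel} level = record
    { level    = level
    ; NC-under = ≤-pred ∘ ∈-tabulate-does⁻ under?
    ; NC-over  = λ j∉NC → ≤-pred (≰⇒> (j∉NC ∘ ∈-tabulate-does⁺ under?))
    ; RS-fresh = x∈∁p⇒x∉p
    ; RS-all   = x∉p⇒x∈∁p
    }
    where
    under? : ∀ j → Dec (suc (covCount I Sel j) ≤ suc s)
    under? j = suc (covCount I Sel j) ≤? suc s

  module Round {s : ℕ} {Sel RS : Subset (m I)} {NC : Subset (nt I)}
               (setup : RoundSetup s Sel NC RS) where
    open RoundSetup setup

    ∉NC⇒suc-s≤ : j ∉ NC → suc s ≤ covCount I (Sel ∪ C) j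
    ∉NC⇒suc-s≤ {C = C} j∉NC =
      ≤-trans (NC-over j∉NC) (covCount-mono Sel (Sel ∪ C) (λ r∈Sel _ → p⊆p∪q C r∈Sel))

    covered⇒suc-s≤ : C ⊆ RS → CoveredBy I C j → suc s ≤ covCount I (Sel ∪ C) j
    covered⇒suc-s≤ {C} {j} C⊆RS (c , c∈C , c-covers) =
      ≤-trans (s≤s (level j))
              (covCount-strict (p⊆p∪q C) (RS-fresh (C⊆RS c∈C)) (q⊆p∪q Sel C c∈C) c-covers)

    level-up : C ⊆ RS → (∀ j → j ∈ NC → CoveredBy I C j) → ∀ j → suc s ≤ covCount I (Sel ∪ C) j
    level-up C⊆RS covered j with j ∈? NC
    ... | yes j∈NC = covered⇒suc-s≤ C⊆RS (covered j j∈NC)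
    ... | no j∉NC  = ∉NC⇒suc-s≤ j∉NC

    LatestStart : Subset (m I) → Fin (nt I) → Fin (m I) → Set
    LatestStart A j t =
      t ∈ A × t ∉ Sel × Covers I t j × (∀ r → r ∈ A → r ∉ Sel → Covers I r j → u I r ℚ.≤ u I t)

    lost-targets-overcovered :
      C ⊆ RS → LeftmostUncovered I NC C j → Sel ∪ C ⊆ A → KCovers I K A → LatestStart A j t →
      Covers I g j → v I t ℚ.≤ v I g → ∀ i → Covers I t i → ¬ Covers I g i → suc K ≤ covCount I A i
    lost-targets-overcovered {C} {j} {A} {K} {t} {g} C⊆RS (j∈NC , j-uncovered , j-leftmost) P⊆A A-covers
                             (_ , _ , _ , t-latest) g-covers-j vt≤vg i t-covers-i g-misses-i =
      +-cancelʳ-≤ s (suc K) (covCount I A i) (begin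
        suc K + s                                 ≡⟨ +-suc K s ⟨
        K + suc s                                 ≤⟨ +-mono-≤ (A-covers j) P-count-i ⟩
        covCount I A j + covCount I (Sel ∪ C) i   ≤⟨ ∣p∩X∣+∣q∩Y∣≤∣p∩Y∣+∣q∩X∣ A _ _ _ P⊆A shifted ⟩
        covCount I A i + covCount I (Sel ∪ C) j   ≤⟨ +-monoʳ-≤ (covCount I A i) P-count-j ⟩
        covCount I A i + s                        ∎)
      where
      open ≤-Reasoning
      xj≰xi : ¬ x I j ℚ.≤ x I i
      xj≰xi xj≤xi = g-misses-i (ℚ.≤-trans (proj₁ g-covers-j) xj≤xi , ℚ.≤-trans (proj₂ t-covers-i) vt≤vg)
      P-count-i : suc s ≤ covCount I (Sel ∪ C) i
      P-count-i with i ∈? NC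
      ... | no i∉NC  = ∉NC⇒suc-s≤ i∉NC
      ... | yes i∈NC = covered⇒suc-s≤ C⊆RS
                         (decidable-stable (CoveredBy? C i) (xj≰xi ∘ j-leftmost i i∈NC))
      P-count-j : covCount I (Sel ∪ C) j ≤ s
      P-count-j = ≤-trans (covCount-mono (Sel ∪ C) Sel (uncovered-∪⁻ j-uncovered)) (NC-under j∈NC)
      shifted : ∀ {r} → r ∈ A → r ∉ Sel ∪ C → r ∈ coverers I j → r ∈ coverers I i
      shifted {r} r∈A r∉P r∈Cj with ur≤xj , xj≤vr ← ∈-coverers⁻ r∈Cj = ∈-coverers⁺
        ( ℚ.≤-trans (t-latest r r∈A (r∉P ∘ p⊆p∪q C) (ur≤xj , xj≤vr)) (proj₁ t-covers-i)
        , ℚ.≤-trans (ℚ.<⇒≤ (ℚ.≰⇒> xj≰xi)) xj≤vr )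

    module _ {K : ℕ} (s<K : s < K) where

      latest-start-exists : ∀ A → KCovers I K A → j ∈ NC → ∃ (LatestStart A j)
      latest-start-exists {j} A A-covers j∈NC
        with r , r∈A∩Cj , r∉Sel∩Cj ←
               ∣q∣<∣p∣⇒∃y∈p∧y∉q (≤-<-trans (NC-under j∈NC) (<-≤-trans s<K (A-covers j)))
        with r∈A , r∈Cj ← x∈p∩q⁻ A (coverers I j) r∈A∩Cj
        with t , (t∈A , t∉Sel , t-covers) , t-latest ←
               ∃-argmax ℚ-≤-totalOrder (λ r → (r ∈? A) ×-dec (¬? (r ∈? Sel) ×-dec Covers? r j)) (u I)
                        (r , r∈A , (λ r∈Sel → r∉Sel∩Cj (x∈p∩q⁺ (r∈Sel , r∈Cj))) , ∈-coverers⁻ r∈Cj) =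
        t , t∈A , t∉Sel , t-covers , λ r r∈A r∉Sel r-covers → t-latest r (r∈A , r∉Sel , r-covers)

      greedy-step : C ⊆ RS → LeftmostUncovered I NC C j → GreedyChoice I RS j g →
                    Extendable K b (Sel ∪ C) → Extendable K b (Sel ∪ (C ∪ ⁅ g ⁆))
      greedy-step {C} {j} {g} {b} C⊆RS lm@(j∈NC , j-uncovered , _)
                  (_ , g-covers-j , g-furthest , _) (A , A-covers , P⊆A , ∣A∣≤b) =
        subst (Extendable K b) (∪-assoc Sel C ⁅ g ⁆) extended
        where
        extended : Extendable K b ((Sel ∪ C) ∪ ⁅ g ⁆)
        extended with g ∈? A
        ... | yes g∈A = A , A-covers , p⊆q∧y∈q⇒p∪⁅y⁆⊆q P⊆A g∈A , ∣A∣≤b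
        ... | no g∉A
          with t , latest@(t∈A , t∉Sel , t-covers-j , _) ← latest-start-exists A A-covers j∈NC =
          replace t g A ,
          replace-KCovers g∉A A-covers (lost-targets-overcovered C⊆RS lm P⊆A A-covers latest g-covers-j
                                           (g-furthest t (RS-all t∉Sel) t-covers-j)) ,
          replace-⊇ P⊆A (λ t∈P → t∉Sel (uncovered-∪⁻ j-uncovered t∈P t-covers-j)) ,
          ≤-trans (∣replace∣≤∣p∣ g A t∈A) ∣A∣≤b

      run-sound : OGARun I NC RS C C′ → C ⊆ RS → Extendable K b (Sel ∪ C) →
                  C′ ⊆ RS × Extendable K b (Sel ∪ C′) × (∀ j → j ∈ NC → CoveredBy I C′ j)
      run-sound (stop covered)       C⊆RS ext = C⊆RS , ext , covered
      run-sound (step _ _ lm gc run) C⊆RS ext =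
        run-sound run (p⊆q∧y∈q⇒p∪⁅y⁆⊆q C⊆RS (proj₁ gc)) (greedy-step C⊆RS lm gc ext)

      run-exists : C ⊆ RS → Extendable K b (Sel ∪ C) → ∃ (OGARun I NC RS C)
      run-exists = go (<-wellFounded _)
        where
        go : ∀ {C} → Acc _<_ ∣ ∁ C ∣ → C ⊆ RS → Extendable K b (Sel ∪ C) → ∃ (OGARun I NC RS C)
        go {C = C} (acc smaller) C⊆RS ext@(A , A-covers , _) with leftmost-uncovered? NC C
        ... | inj₁ covered = C , stop covered
        ... | inj₂ (j , lm@(j∈NC , j-uncovered , _))
          with t , _ , t∉Sel , t-covers-j , _ ← latest-start-exists A A-covers j∈NC
          with g , gc@(g∈RS , g-covers-j , _) ← greedy-choice-exists (t , RS-all t∉Sel , t-covers-j)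
          with C′ , run ← go (smaller (y∉p⇒∣∁[p∪⁅y⁆]∣<∣∁p∣ λ g∈C → j-uncovered (g , g∈C , g-covers-j)))
                             (p⊆q∧y∈q⇒p∪⁅y⁆⊆q C⊆RS g∈RS) (greedy-step C⊆RS lm gc ext) =
          C′ , step j g lm gc run

      Sel∪∅-Extendable : Extendable K b Sel → Extendable K b (Sel ∪ ∅)
      Sel∪∅-Extendable = subst (Extendable K _) (sym (∪-identityʳ Sel))

      round-sound : OGA I NC RS C → Extendable K b Sel →
                    Extendable K b (Sel ∪ C) × (∀ j → suc s ≤ covCount I (Sel ∪ C) j)
      round-sound oga ext with C⊆RS , ext′ , covered ← run-sound oga ⊥⊆ (Sel∪∅-Extendable ext) =
        ext′ , level-up C⊆RS covered

      round-exists : Extendable K b Sel → ∃ (OGA I NC RS)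
      round-exists ext = run-exists ⊥⊆ (Sel∪∅-Extendable ext)

  KRun-sound : KRun I K s Sel Out → (∀ j → s ≤ covCount I Sel j) → Extendable K b Sel →
               KCovers I K Out × ∣ Out ∣ ≤ b
  KRun-sound (done covers) _ ext = covers , Extendable⇒∣P∣≤b ext
  KRun-sound (next (j , count<K) oga run) level ext
    with ext′ , level′ ← Round.round-sound (later-round level) (≤-<-trans (level j) count<K) oga ext =
    KRun-sound run level′ ext′

  KRun-exists : ∀ f → K ≤ f + s → (∀ j → s ≤ covCount I Sel j) → Extendable K b Sel →
                ∃ (KRun I K s Sel)
  KRun-exists {K} {s} {Sel} f K≤f+s level ext with any? (λ j → covCount I Sel j <? K)
  ... | no none = Sel , done (λ j → ≮⇒≥ (λ count<K → none (j , count<K)))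
  ... | yes (j , count<K) with f
  ...   | zero   = contradiction (≤-trans K≤f+s (level j)) (<⇒≱ count<K)
  ...   | suc f′
    with s<K ← ≤-<-trans (level j) count<K
    with C , oga ← Round.round-exists (later-round level) s<K ext
    with ext′ , level′ ← Round.round-sound (later-round level) s<K oga ext
    with Out , run ← KRun-exists f′ (subst (K ≤_) (sym (+-suc f′ s)) K≤f+s) level′ ext′ =
    Out , next (j , count<K) oga run

  first-round-sound : 1 ≤ K → OGA I Full Full C → Extendable K b ∅ →
                      Extendable K b C × (∀ j → 1 ≤ covCount I C j)
  first-round-sound {K = K} {C = C} {b = b} 1≤K oga ext =
    subst (λ P → Extendable K b P × (∀ j → 1 ≤ covCount I P j)) (∪-identityˡ C)
          (Round.round-sound first-round 1≤K oga ext)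

  KOGA-sound : 1 ≤ K → KOGA I K Out → Extendable K b ∅ → KCovers I K Out × ∣ Out ∣ ≤ b
  KOGA-sound 1≤K (C , oga , run) ext with ext′ , level′ ← first-round-sound 1≤K oga ext =
    KRun-sound run level′ ext′

  KOGA-exists : 1 ≤ K → Extendable K b ∅ → ∃ (KOGA I K)
  KOGA-exists {K} 1≤K ext
    with C , oga ← Round.round-exists first-round 1≤K ext
    with ext′ , level′ ← first-round-sound 1≤K oga ext
    with Out , run ← KRun-exists K (m≤m+n K 1) level′ ext′ =
    Out , C , oga , run

theorem3 : (I : Instance) → Sorted I → (K : ℕ) → 1 ≤ K →
           (∃[ A ] KCovers I K A) →
           (∃[ Out ] KOGA I K Out) ×
           (∀ (Out : Subset (m I)) → KOGA I K Out →
              KCovers I K Out × (∀ (A : Subset (m I)) → KCovers I K A → ∣ Out ∣ ≤ ∣ A ∣))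
-- The targets need not be sorted: LeftmostUncovered compares coordinates directly.
theorem3 I _ K 1≤K (A , A-covers) =
  KOGA-exists I 1≤K (KCovers⇒Extendable I A A-covers) ,
  λ Out koga → proj₁ (KOGA-sound I 1≤K koga (KCovers⇒Extendable I A A-covers)) ,
               λ B B-covers → proj₂ (KOGA-sound I 1≤K koga (KCovers⇒Extendable I B B-covers))
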